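{- For all $\ell\ge1$ and all sequences $[t_1\cdots t_k]$ of terms, $\mathrm{Slow}_\ell([t_1\cdots t_k])=\sum_{i=1}^k \mathrm{Slow}_\ell(t_i)$.
   Context: $\mathcal F$ is a finite signature, $\mathcal V$ a set of variables, $\sqsupset$ a precedence (strict order) on $\mathcal F$. Sequences: with a fresh variadic symbol $\mathsf{list}$, a sequence is $[t_1\cdots t_k]=\mathsf{list}(t_1,\dots,t_k)$ with $t_i\in\mathcal T(\mathcal F,\mathcal V)$. Concatenation $[s_1\cdots s_k]\mathbin{+\!\!+}[t_1\cdots t_l]=[s_1\cdots s_k\,t_1\cdots t_l]$, extended to terms by identifying $t$ with $[t]$. $\rhd$ is the strict superterm relation. Product extension $(a_i)_{i\le k}>^{\mathrm{prod}}(b_i)_{i\le k}$: $a_i=b_i$ or $a_i>b_i$ for all $i$, strict for some $j$. For $\ell\ge1$, $a\blacktriangleright_\ell b$ (for terms or sequences) iff: (1) $a=f(s_1,\dots,s_k)$, $b=g(t_1,\dots,t_l)$, $f\sqsupset g$, $a\rhd t_j$ for all $j$, $l\le\ell$; or (2) $a=f(s_1,\dots,s_k)$, $b=f(t_1,\dots,t_k)$, $(s_i)\rhd^{\mathrm{prod}}(t_i)$; or (3) $a=f(s_1,\dots,s_k)$, $b=[t_1\cdots t_l]$, $a\blacktriangleright_\ell t_j$ for all $j$, $l\le\ell$; or (4) $a=[s_1\cdots s_k]$, $b=[t_1\cdots t_l]=b_1\mathbin{+\!\!+}\cdots\mathbin{+\!\!+}b_k$ for terms or sequences $b_i$ with $(s_1,\dots,s_k)\blacktriangleright_\ell^{\mathrm{prod}}(b_1,\dots,b_k)$.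 $\mathrm{Slow}_\ell(a)=\max\{l\mid \exists a_1,\dots,a_l.\ a\blacktriangleright_\ell a_1\blacktriangleright_\ell\cdots\blacktriangleright_\ell a_l\}$, the length of a longest $\blacktriangleright_\ell$-descending sequence from $a$. -}

module Defs where

open import Data.Nat using (ℕ; zero; suc; _≤_)
open import Data.Fin using (Fin)
open import Data.Vec using (Vec)
import Data.Vec as Vec
open import Data.List using (List; []; _∷_; length; concat; map)
open import Data.List.Relation.Unary.All using (All)
open import Data.List.Relation.Unary.Any using (Any)
open import Data.Product using (Σ; ∃; _×_)
open import Data.Sum using (_⊎_)
open import Function.Bundles using (_↔_)
open import Relation.Binary.Core using (Rel)
open import Relation.Binary.Structures using (IsStrictPartialOrder)
open import Relation.Binary.PropositionalEquality using (_≡_)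

record Signature : Set₁ where
  field
    F      : Set
    arity  : F → ℕ
    finite : Σ ℕ (λ n → F ↔ Fin n)
    V      : Set
    _⊐_    : Rel F _
    ⊐-spo  : IsStrictPartialOrder _≡_ _⊐_

-- Product extension (for lists of equal length) of a relation R : A → B → Set,
-- where elements are compared with equality via an embedding e : A → B.
module _ {A B : Set} (e : A → B) (R : A → B → Set) where

  data ProdWeak : List A → List B → Set where
    []  : ProdWeak [] []
    _∷_ : ∀ {a b as bs} → (e a ≡ b ⊎ R a b) → ProdWeak as bs → ProdWeak (a ∷ as) (b ∷ bs)

  data ProdStrict : List A → List B → Set where
    here  : ∀ {a b as bs} → R a b → ProdWeak as bs → ProdStrict (a ∷ as) (b ∷ bs)
    there : ∀ {a b as bs} → (e a ≡ b ⊎ R a b) → ProdStrict as bs → ProdStrict (a ∷ as) (b ∷ bs)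

module Terms (S : Signature) where
  open Signature S

  data Term : Set where
    var : V → Term
    fun : (f : F) → Vec Term (arity f) → Term

  data _⊳_ : Term → Term → Set where
    arg : ∀ {f ts t} → Any (t ≡_) (Vec.toList ts) → fun f ts ⊳ t
    sub : ∀ {f ts t} → Any (_⊳ t) (Vec.toList ts) → fun f ts ⊳ t

  -- objects compared by ▶ : terms or sequences [t₁ ⋯ tₖ] = list(t₁,…,tₖ)
  data Obj : Set where
    term : Term → Obj
    seq  : List Term → Obj

  -- the list of terms of an object, identifying t with [t]
  elems : Obj → List Term
  elems (term t) = t ∷ []
  elems (seq ts) = ts

  data _▶[_]_ : Obj → ℕ → Obj → Set where
    r1 : ∀ {ℓ f g ss ts} → f ⊐ g → All (fun f ss ⊳_) (Vec.toList ts) → arity g ≤ ℓ →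
         term (fun f ss) ▶[ ℓ ] term (fun g ts)
    r2 : ∀ {ℓ f ss ts} → ProdStrict (λ x → x) _⊳_ (Vec.toList ss) (Vec.toList ts) →
         term (fun f ss) ▶[ ℓ ] term (fun f ts)
    r3 : ∀ {ℓ f ss ts} → All (λ t → term (fun f ss) ▶[ ℓ ] term t) ts → length ts ≤ ℓ →
         term (fun f ss) ▶[ ℓ ] seq ts
    r4 : ∀ {ℓ ss} (bs : List Obj) →
         ProdStrict term (λ s b → term s ▶[ ℓ ] b) ss bs →
         seq ss ▶[ ℓ ] seq (concat (map elems bs))

  data Chain (ℓ : ℕ) : Obj → ℕ → Set where
    stop : ∀ {a} → Chain ℓ a zero
    step : ∀ {a b n} → a ▶[ ℓ ] b → Chain ℓ b n → Chain ℓ a (suc n)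

  -- IsSlow ℓ a n : n = Slowₗ(a), the maximum length of a ▶ₗ-descending sequence from a
  IsSlow : ℕ → Obj → ℕ → Set
  IsSlow ℓ a n = Chain ℓ a n × (∀ m → Chain ℓ a m → m ≤ n)

module Submission where

-- A ▶ₗ-step from a sequence (rule 4) replaces each element sᵢ by a block bᵢ,
-- with sᵢ ▶ₗ bᵢ or bᵢ = sᵢ, strictly in at least one position.  Hence steps
-- from a concatenation xs ++ ys act independently on xs and on ys:
--   * (≥) steps on xs (ys untouched) followed by steps on ys form a chain
--     from xs ++ ys, so chains of lengths p and q concatenate to one of
--     length p + q;
--   * (≤) every step from xs ++ ys splits into a strict step on one part and
--     a step-or-identity on the other, so a chain of length m from xs ++ ys
--     splits into chains of lengths p and q from xs and ys with m ≤ p + q.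
-- Finally, chains from a term t and from the singleton [t] correspond.

open import Defs
open import Data.Nat using (ℕ; _≤_; suc; _+_; z≤n; s≤s)
open import Data.Nat.Properties using (≤-refl; ≤-trans; ≤-reflexive; +-mono-≤; +-monoʳ-≤; +-suc; n≤1+n)
open import Data.List using (List; []; _∷_; _++_; concat; map)
open import Data.List.Properties using (++-identityʳ; map-++; concat-++)
open import Data.Nat.ListAction using (sum)
open import Data.List.Relation.Binary.Pointwise using (Pointwise; []; _∷_)
open import Data.Product using (∃; ∃₂; _×_; _,_)
open import Data.Sum using (_⊎_; inj₁; inj₂)
open import Relation.Binary.PropositionalEquality using (_≡_; refl; sym; trans; cong)

module ProductExtension {A B : Set} (e : A → B) (R : A → B → Set) where

  Weak Strict : List A → List B → Set
  Weak   = ProdWeak e R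
  Strict = ProdStrict e R

  weak-refl : ∀ xs → Weak xs (map e xs)
  weak-refl []       = []
  weak-refl (x ∷ xs) = inj₁ refl ∷ weak-refl xs

  weak-++ : ∀ {xs bs ys cs} → Weak xs bs → Weak ys cs → Weak (xs ++ ys) (bs ++ cs)
  weak-++ []      w = w
  weak-++ (r ∷ v) w = r ∷ weak-++ v w

  strict-++-weak : ∀ {xs bs ys cs} → Strict xs bs → Weak ys cs → Strict (xs ++ ys) (bs ++ cs)
  strict-++-weak (here r v)  w = here r (weak-++ v w)
  strict-++-weak (there r s) w = there r (strict-++-weak s w)

  weak-++-strict : ∀ {xs bs ys cs} → Weak xs bs → Strict ys cs → Strict (xs ++ ys) (bs ++ cs)
  weak-++-strict []      s = s
  weak-++-strict (r ∷ v) s = there r (weak-++-strict v s)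

  strict⇒weak : ∀ {xs bs} → Strict xs bs → Weak xs bs
  strict⇒weak (here r v)  = inj₂ r ∷ v
  strict⇒weak (there r s) = r ∷ strict⇒weak s

  weak⇒refl⊎strict : ∀ {xs bs} → Weak xs bs → bs ≡ map e xs ⊎ Strict xs bs
  weak⇒refl⊎strict [] = inj₁ refl
  weak⇒refl⊎strict (inj₁ refl ∷ w) with weak⇒refl⊎strict w
  ... | inj₁ eq = inj₁ (cong (_ ∷_) eq)
  ... | inj₂ s  = inj₂ (there (inj₁ refl) s)
  weak⇒refl⊎strict (inj₂ r ∷ w) = inj₂ (here r w)

  weak-split : ∀ xs {ys bs} → Weak (xs ++ ys) bs →
               ∃₂ λ bs₁ bs₂ → bs ≡ bs₁ ++ bs₂ × Weak xs bs₁ × Weak ys bs₂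
  weak-split []       w = [] , _ , refl , [] , w
  weak-split (x ∷ xs) (r ∷ w) with weak-split xs w
  ... | bs₁ , bs₂ , refl , w₁ , w₂ = _ ∷ bs₁ , bs₂ , refl , r ∷ w₁ , w₂

  StrictOnOnePart : List A → List A → List B → List B → Set
  StrictOnOnePart xs ys bs₁ bs₂ = Strict xs bs₁ × Weak ys bs₂ ⊎ Weak xs bs₁ × Strict ys bs₂

  strict-split : ∀ xs {ys bs} → Strict (xs ++ ys) bs →
                 ∃₂ λ bs₁ bs₂ → bs ≡ bs₁ ++ bs₂ × StrictOnOnePart xs ys bs₁ bs₂
  strict-split [] s = [] , _ , refl , inj₂ ([] , s)
  strict-split (x ∷ xs) (here r w) with weak-split xs w
  ... | bs₁ , bs₂ , refl , w₁ , w₂ = _ ∷ bs₁ , bs₂ , refl , inj₁ (here r w₁ , w₂)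
  strict-split (x ∷ xs) (there r s) with strict-split xs s
  ... | bs₁ , bs₂ , refl , inj₁ (s₁ , w₂) = _ ∷ bs₁ , bs₂ , refl , inj₁ (there r s₁ , w₂)
  ... | bs₁ , bs₂ , refl , inj₂ (w₁ , s₂) = _ ∷ bs₁ , bs₂ , refl , inj₂ (r ∷ w₁ , s₂)

module Chains (S : Signature) (ℓ : ℕ) where
  open Terms S

  _▶ₗ_ : Term → Obj → Set
  s ▶ₗ b = term s ▶[ ℓ ] b

  open ProductExtension term _▶ₗ_

  flatten : List Obj → List Term
  flatten bs = concat (map elems bs)

  flatten-++ : ∀ bs cs → flatten (bs ++ cs) ≡ flatten bs ++ flatten cs
  flatten-++ bs cs =
    trans (cong concat (map-++ elems bs cs)) (sym (concat-++ (map elems bs) (map elems cs)))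

  flatten-terms : ∀ ts → flatten (map term ts) ≡ ts
  flatten-terms []       = refl
  flatten-terms (t ∷ ts) = cong (t ∷_) (flatten-terms ts)

  seq-step : ∀ {ss ts} bs → Strict ss bs → flatten bs ≡ ts → seq ss ▶[ ℓ ] seq ts
  seq-step bs s refl = r4 bs s

  castChain : ∀ {xs ys n} → xs ≡ ys → Chain ℓ (seq xs) n → Chain ℓ (seq ys) n
  castChain refl c = c

  -- A chain from t yields one from [t]: each step b of t is the step [b] of [t].
  to-singleton : ∀ {a n} → Chain ℓ a n → Chain ℓ (seq (elems a)) n
  to-singleton {term t} stop        = stop
  to-singleton {term t} (step r c) =
    step (r4 (_ ∷ []) (here r [])) (castChain (sym (++-identityʳ _)) (to-singleton c))
  to-singleton {seq ts} c = c

  -- Conversely a chain from [t] is one from t: [t] can only step to a block [b] with t ▶ₗ b.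
  from-singleton : ∀ {b xs n} → xs ≡ elems b → Chain ℓ (seq xs) n → Chain ℓ b n
  from-singleton {seq vs} eq   c    = castChain eq c
  from-singleton {term t} refl stop = stop
  from-singleton {term t} refl (step (r4 (b ∷ []) (here r [])) c) =
    step r (from-singleton (++-identityʳ (elems b)) c)
  from-singleton {term t} refl (step (r4 _ (there _ ())) _)

  step-++ʳ : ∀ {xs xs'} ys → seq xs ▶[ ℓ ] seq xs' → seq (xs ++ ys) ▶[ ℓ ] seq (xs' ++ ys)
  step-++ʳ ys (r4 bs s) =
    seq-step (bs ++ map term ys) (strict-++-weak s (weak-refl ys))
      (trans (flatten-++ bs (map term ys)) (cong (flatten bs ++_) (flatten-terms ys)))

  step-++ˡ : ∀ xs {ys ys'} → seq ys ▶[ ℓ ] seq ys' → seq (xs ++ ys) ▶[ ℓ ] seq (xs ++ ys')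
  step-++ˡ xs (r4 bs s) =
    seq-step (map term xs ++ bs) (weak-++-strict (weak-refl xs) s)
      (trans (flatten-++ (map term xs) bs) (cong (_++ flatten bs) (flatten-terms xs)))

  chain-++ˡ : ∀ xs {ys q} → Chain ℓ (seq ys) q → Chain ℓ (seq (xs ++ ys)) q
  chain-++ˡ xs stop                = stop
  chain-++ˡ xs (step (r4 bs s) c) = step (step-++ˡ xs (r4 bs s)) (chain-++ˡ xs c)

  chain-++ : ∀ {xs ys p q} → Chain ℓ (seq xs) p → Chain ℓ (seq ys) q → Chain ℓ (seq (xs ++ ys)) (p + q)
  chain-++ {xs} stop d                     = chain-++ˡ xs d
  chain-++ {ys = ys} (step (r4 bs s) c) d = step (step-++ʳ ys (r4 bs s)) (chain-++ c d)

  ChainSplit : List Term → List Term → ℕ → Set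
  ChainSplit xs ys m = ∃₂ λ p q → m ≤ p + q × Chain ℓ (seq xs) p × Chain ℓ (seq ys) q

  -- Prefixing a weak step to a chain loses no length (it is the identity or one more step).
  weak-chain : ∀ {xs bs q} → Weak xs bs → Chain ℓ (seq (flatten bs)) q →
               ∃ λ q' → q ≤ q' × Chain ℓ (seq xs) q'
  weak-chain {xs} w c with weak⇒refl⊎strict w
  ... | inj₁ refl = _ , ≤-refl , castChain (flatten-terms xs) c
  ... | inj₂ s    = _ , n≤1+n _ , step (r4 _ s) c

  extend-split : ∀ {xs ys bs₁ bs₂ m} → StrictOnOnePart xs ys bs₁ bs₂ →
                 ChainSplit (flatten bs₁) (flatten bs₂) m → ChainSplit xs ys (suc m)
  extend-split (inj₁ (s₁ , w₂)) (p , q , m≤p+q , c₁ , c₂) with weak-chain w₂ c₂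
  ... | q' , q≤q' , c₂' =
    suc p , q' , s≤s (≤-trans m≤p+q (+-monoʳ-≤ p q≤q')) , step (r4 _ s₁) c₁ , c₂'
  extend-split (inj₂ (w₁ , s₂)) (p , q , m≤p+q , c₁ , c₂) with weak-chain w₁ c₁
  ... | p' , p≤p' , c₁' =
    p' , suc q , ≤-trans (s≤s (≤-trans m≤p+q (+-mono-≤ p≤p' ≤-refl))) (≤-reflexive (sym (+-suc p' q)))
      , c₁' , step (r4 _ s₂) c₂

  -- Upper bound: split the first step (strict on one part) and recurse;
  -- the equation zs ≡ xs ++ ys keeps the recursion structural.
  split-chain : ∀ xs ys {zs m} → zs ≡ xs ++ ys → Chain ℓ (seq zs) m → ChainSplit xs ys m
  split-chain xs ys eq stop = 0 , 0 , z≤n , stop , stop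
  split-chain xs ys refl (step (r4 bs s) c) with strict-split xs s
  ... | bs₁ , bs₂ , refl , parts =
    extend-split parts (split-chain (flatten bs₁) (flatten bs₂) (flatten-++ bs₁ bs₂) c)

  SlowTerms : List Term → List ℕ → Set
  SlowTerms = Pointwise (λ t n → IsSlow ℓ (term t) n)

  slow-lower : ∀ {ts ns} → SlowTerms ts ns → Chain ℓ (seq ts) (sum ns)
  slow-lower []             = stop
  slow-lower ((c , _) ∷ ps) = chain-++ (to-singleton c) (slow-lower ps)

  slow-upper : ∀ {ts ns} → SlowTerms ts ns → ∀ m → Chain ℓ (seq ts) m → m ≤ sum ns
  slow-upper [] _ stop                   = z≤n
  slow-upper [] _ (step (r4 _ ()) _)
  slow-upper {t ∷ ts} ((_ , maximal) ∷ ps) m c with split-chain (t ∷ []) ts refl c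
  ... | p , q , m≤p+q , c₁ , c₂ =
    ≤-trans m≤p+q (+-mono-≤ (maximal p (from-singleton refl c₁)) (slow-upper ps q c₂))

-- Slowₗ([t₁ ⋯ tₖ]) = Σᵢ Slowₗ(tᵢ).
lemma3 : (S : Signature) (ℓ : ℕ) → 1 ≤ ℓ →
    (ts : List (Terms.Term S)) (ns : List ℕ) →
    Pointwise (λ t n → Terms.IsSlow S ℓ (Terms.term t) n) ts ns →
    Terms.IsSlow S ℓ (Terms.seq ts) (sum ns)
lemma3 S ℓ _ ts ns slow = slow-lower slow , slow-upper slow
  where open Chains S ℓ
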